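{- For all closed terms $P$ and $Q$ over $\Sigma_{CP}(A)$: if $\mathrm{CP}_{cr}\vdash P=Q$ then $P=_{cr}Q$.
   Context: Fix a finite non-empty set $A$ of atomic propositions. Closed terms are built from $T$, $F$, $a\in A$ by conditional composition $P\triangleleft Q\triangleright R$. $\mathrm{CP}_{cr}$ consists of (CP1) $x\triangleleft T\triangleright y=x$, (CP2) $x\triangleleft F\triangleright y=y$, (CP3) $T\triangleleft x\triangleright F=x$, (CP4) $x\triangleleft(y\triangleleft z\triangleright u)\triangleright v=(x\triangleleft y\triangleright v)\triangleleft z\triangleright(x\triangleleft u\triangleright v)$, and for every $a\in A$: (CPcr1) $(x\triangleleft a\triangleright y)\triangleleft a\triangleright z=x\triangleleft a\triangleright z$, (CPcr2) $x\triangleleft a\triangleright(y\triangleleft a\triangleright z)=x\triangleleft a\triangleright z$; $\vdash$ is equational derivability. A reactive valuation algebra (RVA) is a set $RV$ with elements $T_{RV},F_{RV}$ and for each $a\in A$ functions $y_a:RV\to\{T,F\}$, $\partial_a:RV\to RV$ with $y_a(T_{RV})=T$, $y_a(F_{RV})=F$, $\partial_a(T_{RV})=T_{RV}$, $\partial_a(F_{RV})=F_{RV}$. For closed $P$ and $H\in RV$: $T/H=T$, $F/H=F$, $a/H=y_a(H)$, $\partial_T(H)=\partial_F(H)=H$; $(P\triangleleft Q\triangleright R)/H=P/\partial_Q(H)$ and $\partial_{P\triangleleft Q\triangleright R}(H)=\partial_P(\partial_Q(H))$ if $Q/H=T$, and $R/\partial_Q(H)$ resp. $\partial_R(\partial_Q(H))$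 if $Q/H=F$. The variety $cr$ (contractive valuations) is the class of RVAs with $y_a(\partial_a(H))=y_a(H)$ and $\partial_a(\partial_a(H))=\partial_a(H)$ for all $a\in A$, $H\in RV$. $P\equiv_{cr}Q$ means $P/H=Q/H$ for all RVAs in $cr$ and all $H$; $=_{cr}$ is the largest congruence (w.r.t. conditional composition) on closed terms contained in $\equiv_{cr}$. -}

module Defs where

open import Data.Nat using (ℕ; suc)
open import Data.Fin using (Fin)
open import Data.Bool using (Bool; true; false; if_then_else_)
open import Data.Empty using (⊥)
open import Data.Product using (Σ; _×_; _,_; proj₁; proj₂)
open import Relation.Binary.PropositionalEquality using (_≡_)
open import Relation.Binary.Structures using (IsEquivalence)

-- The set of atoms A is  Fin (suc n)  (finite, non-empty).
-- Terms over Σ_CP(A) with variables drawn from X.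
data Term (n : ℕ) (X : Set) : Set where
  var   : X → Term n X
  T     : Term n X
  F     : Term n X
  atom  : Fin (suc n) → Term n X
  _◁_▷_ : Term n X → Term n X → Term n X → Term n X

Closed : ℕ → Set
Closed n = Term n ⊥

infix 4 CPcr⊢_≈_
data CPcr⊢_≈_ {n : ℕ} {X : Set} : Term n X → Term n X → Set where
  cp1    : ∀ x y → CPcr⊢ (x ◁ T ▷ y) ≈ x
  cp2    : ∀ x y → CPcr⊢ (x ◁ F ▷ y) ≈ y
  cp3    : ∀ x → CPcr⊢ (T ◁ x ▷ F) ≈ x
  cp4    : ∀ x y z u v →
           CPcr⊢ (x ◁ (y ◁ z ▷ u) ▷ v) ≈ ((x ◁ y ▷ v) ◁ z ▷ (x ◁ u ▷ v))
  cpcr1  : ∀ (a : Fin (suc n)) x y z →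
           CPcr⊢ ((x ◁ atom a ▷ y) ◁ atom a ▷ z) ≈ (x ◁ atom a ▷ z)
  cpcr2  : ∀ (a : Fin (suc n)) x y z →
           CPcr⊢ (x ◁ atom a ▷ (y ◁ atom a ▷ z)) ≈ (x ◁ atom a ▷ z)
  refl   : ∀ {s} → CPcr⊢ s ≈ s
  sym    : ∀ {s t} → CPcr⊢ s ≈ t → CPcr⊢ t ≈ s
  trans  : ∀ {s t u} → CPcr⊢ s ≈ t → CPcr⊢ t ≈ u → CPcr⊢ s ≈ u
  cong   : ∀ {s s' t t' u u'} → CPcr⊢ s ≈ s' → CPcr⊢ t ≈ t' → CPcr⊢ u ≈ u' →
           CPcr⊢ (s ◁ t ▷ u) ≈ (s' ◁ t' ▷ u')

-- Reactive valuation algebras (truth values {T,F} rendered as Bool, T = true).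
record RVA (n : ℕ) : Set₁ where
  field
    Carrier : Set
    T-RV    : Carrier
    F-RV    : Carrier
    y       : Fin (suc n) → Carrier → Bool
    ∂       : Fin (suc n) → Carrier → Carrier
    y-T     : ∀ a → y a T-RV ≡ true
    y-F     : ∀ a → y a F-RV ≡ false
    ∂-T     : ∀ a → ∂ a T-RV ≡ T-RV
    ∂-F     : ∀ a → ∂ a F-RV ≡ F-RV

IsCr : ∀ {n} → RVA n → Set
IsCr {n} V = ∀ (a : Fin (suc n)) (H : RVA.Carrier V) →
  (RVA.y V a (RVA.∂ V a H) ≡ RVA.y V a H) × (RVA.∂ V a (RVA.∂ V a H) ≡ RVA.∂ V a H)

-- Simultaneous evaluation: eval V P H = (P / H , ∂_P(H)).
eval : ∀ {n} (V : RVA n) → Closed n → RVA.Carrier V → Bool × RVA.Carrier V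
eval V (var ())
eval V T H = true , H
eval V F H = false , H
eval V (atom a) H = RVA.y V a H , RVA.∂ V a H
eval V (P ◁ Q ▷ R) H with eval V Q H
... | true  , H' = eval V P H'
... | false , H' = eval V R H'

_/_ : ∀ {n} {V : RVA n} → Closed n → RVA.Carrier V → Bool
_/_ {V = V} P H = proj₁ (eval V P H)

∂[_] : ∀ {n} {V : RVA n} → Closed n → RVA.Carrier V → RVA.Carrier V
∂[_] {V = V} P H = proj₂ (eval V P H)

_≡cr_ : ∀ {n} → Closed n → Closed n → Set₁
_≡cr_ {n} P Q = ∀ (V : RVA n) → IsCr V → ∀ (H : RVA.Carrier V) →
  _/_ {V = V} P H ≡ _/_ {V = V} Q H

record IsCongruence {n : ℕ} (R : Closed n → Closed n → Set₁) : Set₁ where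
  field
    isEquivalence : IsEquivalence R
    compat : ∀ {P P' Q Q' S S'} → R P P' → R Q Q' → R S S' →
             R (P ◁ Q ▷ S) (P' ◁ Q' ▷ S')

-- P =_cr Q : (P,Q) lies in the largest congruence contained in ≡_cr,
-- i.e. some congruence contained in ≡_cr relates P and Q.
_=cr_ : ∀ {n} → Closed n → Closed n → Set₂
_=cr_ {n} P Q = Σ (Closed n → Closed n → Set₁) λ R →
  IsCongruence R × (∀ {P' Q'} → R P' Q' → P' ≡cr Q') × R P Q

-- Every axiom of CP_cr holds for the simultaneous evaluation (P / H , ∂_P(H)),
-- not only for the reply P / H: CP1–CP4 in any reactive valuation algebra,
-- CPcr1/CPcr2 because in a contractive one a repeated atom a meets the same
-- reply and the same valuation ∂_a(H) as its first occurrence. Since evaluation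
-- is compositional, equal evaluations are preserved by conditional composition,
-- so derivability itself is a congruence contained in ≡_cr.
module Submission where

open import Defs
open import Data.Nat using (ℕ)
open import Data.Bool using (true; false)
open import Data.Product using (_,_; proj₁; proj₂)
open import Level using (Lift; lift; lower)
import Relation.Binary.PropositionalEquality as Eq
open Eq using (_≡_)

module _ {n : ℕ} (V : RVA n) (contractive : IsCr V) where
  open RVA V

  eval-respects-⊢ : ∀ {P Q : Closed n} → CPcr⊢ P ≈ Q → ∀ H → eval V P H ≡ eval V Q H
  eval-respects-⊢ (cp1 _ _) H = Eq.refl
  eval-respects-⊢ (cp2 _ _) H = Eq.refl
  eval-respects-⊢ (cp3 x) H with eval V x H
  ... | true  , H' = Eq.refl
  ... | false , H' = Eq.refl
  eval-respects-⊢ (cp4 _ y z u _) H with eval V z H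
  ... | true , H' with eval V y H'
  ...   | true  , H'' = Eq.refl
  ...   | false , H'' = Eq.refl
  eval-respects-⊢ (cp4 _ y z u _) H | false , H' with eval V u H'
  ...   | true  , H'' = Eq.refl
  ...   | false , H'' = Eq.refl
  eval-respects-⊢ (cpcr1 a _ _ _) H with y a H in ya≡
  ... | false = Eq.refl
  ... | true rewrite proj₁ (contractive a H) | ya≡ | proj₂ (contractive a H) = Eq.refl
  eval-respects-⊢ (cpcr2 a _ _ _) H with y a H in ya≡
  ... | true = Eq.refl
  ... | false rewrite proj₁ (contractive a H) | ya≡ | proj₂ (contractive a H) = Eq.refl
  eval-respects-⊢ refl H = Eq.refl
  eval-respects-⊢ (sym p) H = Eq.sym (eval-respects-⊢ p H)
  eval-respects-⊢ (trans p q) H = Eq.trans (eval-respects-⊢ p H) (eval-respects-⊢ q H)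
  eval-respects-⊢ (cong {t = t} p q r) H
    rewrite Eq.sym (eval-respects-⊢ q H) with eval V t H
  ... | true  , H' = eval-respects-⊢ p H'
  ... | false , H' = eval-respects-⊢ r H'

Derivable : ∀ {n} → Closed n → Closed n → Set₁
Derivable P Q = Lift _ (CPcr⊢ P ≈ Q)

Derivable-isCongruence : ∀ {n} → IsCongruence (Derivable {n})
Derivable-isCongruence = record
  { isEquivalence = record
    { refl  = lift refl
    ; sym   = λ p → lift (sym (lower p))
    ; trans = λ p q → lift (trans (lower p) (lower q))
    }
  ; compat = λ p q r → lift (cong (lower p) (lower q) (lower r))
  }

Derivable⇒≡cr : ∀ {n} {P Q : Closed n} → Derivable P Q → P ≡cr Q
Derivable⇒≡cr p V contractive H = Eq.cong proj₁ (eval-respects-⊢ V contractive (lower p) H)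

mainTheorem7 : ∀ (n : ℕ) (P Q : Closed n) → CPcr⊢ P ≈ Q → P =cr Q
mainTheorem7 n P Q P≈Q = Derivable , Derivable-isCongruence , Derivable⇒≡cr , lift P≈Q
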